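{- Let $r\ge 1$, let $G$ be a graph with $\Delta(G)\le r$, and let $T$ be a cluster of $G$ whose associated graph $R$ is isomorphic to $K_{1,p}\cup qK_2$ for some integers $p,q\ge 0$. Then $T$ is either dischargeable or foldable.
   Context: For an edge $xy$ of $G$, $w(xy)=|N(x)\cap N(y)|$. An edge is tight if $w(xy)=r-1$; a tight clique is a clique all of whose edges are tight; a cluster is a maximal tight clique with at least two vertices. For a cluster $T$ with $t=|T|$, let $S=\bigcap_{x\in T}N(x)$, $s=|S|$, and let $R$ (the associated graph) be the graph on $S$ whose edges are the pairs of $S$ non-adjacent in $G$. For a graph $H$, $\mu(H)=2\#(H,K_3)+\#(H,P_3)$, counting 3-subsets inducing a triangle, respectively a path with two edges. $T$ is dischargeable if $2e(R)\ge s+t-1$, and foldable if $t\cdot e(R)\ge \mu(R)$. $K_{1,p}\cup qK_2$ is the disjoint union of a star with $p$ leaves and $q$ disjoint edges. -}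

module Defs where

open import Data.Nat using (ℕ; zero; suc; _+_; _*_; _∸_; _≤_; _<_; _≥_; _<ᵇ_)
open import Data.Bool using (Bool; true; false; _∧_; _∨_; not; if_then_else_)
open import Data.Fin using (Fin; zero; suc; toℕ; _≟_)
open import Data.Fin.Subset using (Subset; _∈_; _⊆_; ∣_∣)
open import Data.Vec using (tabulate; lookup)
open import Data.List using (List; allFin; map)
open import Data.Bool.ListAction using (all)
open import Data.Nat.ListAction using (sum)
open import Data.Product using (Σ; ∃; _×_; _,_)
open import Data.Sum using (_⊎_; inj₁; inj₂)
open import Relation.Binary.PropositionalEquality using (_≡_; _≢_)
open import Relation.Nullary.Decidable using (⌊_⌋)
open import Function.Definitions using (Injective)

record Graph (n : ℕ) : Set where
  field
    adj    : Fin n → Fin n → Bool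
    sym    : ∀ x y → adj x y ≡ adj y x
    irrefl : ∀ x → adj x x ≡ false
open Graph public

module _ {n : ℕ} (G : Graph n) where

  N : Fin n → Subset n
  N x = tabulate (adj G x)

  count : (Fin n → Bool) → ℕ
  count f = ∣ tabulate f ∣

  MaxDegree≤ : ℕ → Set
  MaxDegree≤ r = ∀ x → ∣ N x ∣ ≤ r

  w : Fin n → Fin n → ℕ
  w x y = count (λ z → adj G x z ∧ adj G y z)

  TightEdge : ℕ → Fin n → Fin n → Set
  TightEdge r x y = (adj G x y ≡ true) × (w x y ≡ r ∸ 1)

  TightClique : ℕ → Subset n → Set
  TightClique r T = ∀ x y → x ∈ T → y ∈ T → x ≢ y → TightEdge r x y

  Cluster : ℕ → Subset n → Set
  Cluster r T = TightClique r T × (2 ≤ ∣ T ∣)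
              × (∀ T' → TightClique r T' → T ⊆ T' → T' ⊆ T)

  inS : Subset n → Fin n → Bool
  inS T v = all (λ x → not (lookup T x) ∨ adj G x v) (allFin n)

  Radj : Subset n → Fin n → Fin n → Bool
  Radj T u v = inS T u ∧ inS T v ∧ not ⌊ u ≟ v ⌋ ∧ not (adj G u v)

  sSize : Subset n → ℕ
  sSize T = count (inS T)

  private
    sumF : (Fin n → ℕ) → ℕ
    sumF f = sum (map f (allFin n))

    increasing : Fin n → Fin n → Fin n → Bool
    increasing u v x = (toℕ u <ᵇ toℕ v) ∧ (toℕ v <ᵇ toℕ x)

  eR : Subset n → ℕ
  eR T = sumF (λ u → count (λ v → (toℕ u <ᵇ toℕ v) ∧ Radj T u v))

  edges3 : Subset n → Fin n → Fin n → Fin n → ℕ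
  edges3 T u v x = b2n (Radj T u v) + b2n (Radj T u x) + b2n (Radj T v x)
    where
      b2n : Bool → ℕ
      b2n true  = 1
      b2n false = 0

  triR : Subset n → ℕ
  triR T = sumF λ u → sumF λ v → count λ x →
    increasing u v x ∧ inS T u ∧ inS T v ∧ inS T x ∧ ⌊ edges3 T u v x Data.Nat.≟ 3 ⌋

  p3R : Subset n → ℕ
  p3R T = sumF λ u → sumF λ v → count λ x →
    increasing u v x ∧ inS T u ∧ inS T v ∧ inS T x ∧ ⌊ edges3 T u v x Data.Nat.≟ 2 ⌋

  μR : Subset n → ℕ
  μR T = 2 * triR T + p3R T

  Dischargeable : Subset n → Set
  Dischargeable T = 2 * eR T ≥ sSize T + ∣ T ∣ ∸ 1

  Foldable : Subset n → Set
  Foldable T = ∣ T ∣ * eR T ≥ μR T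

-- Vertex type of K_{1,p} ∪ qK_2: the star has centre inj₁ zero and leaves
-- inj₁ (suc i); the k-th matching edge joins inj₂ (k , false) and inj₂ (k , true).
StarMatchV : ℕ → ℕ → Set
StarMatchV p q = Fin (suc p) ⊎ (Fin q × Bool)

starMatchAdj : (p q : ℕ) → StarMatchV p q → StarMatchV p q → Bool
starMatchAdj p q (inj₁ zero)    (inj₁ zero)    = false
starMatchAdj p q (inj₁ zero)    (inj₁ (suc _)) = true
starMatchAdj p q (inj₁ (suc _)) (inj₁ zero)    = true
starMatchAdj p q (inj₁ (suc _)) (inj₁ (suc _)) = false
starMatchAdj p q (inj₁ _)       (inj₂ _)       = false
starMatchAdj p q (inj₂ _)       (inj₁ _)       = false
starMatchAdj p q (inj₂ (k , b)) (inj₂ (k' , b')) =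
  ⌊ k ≟ k' ⌋ ∧ not ⌊ b Data.Bool.≟ b' ⌋

RIsoStarMatching : {n : ℕ} → Graph n → Subset n → ℕ → ℕ → Set
RIsoStarMatching {n} G T p q =
  Σ (StarMatchV p q → Fin n) λ f →
      Injective _≡_ _≡_ f
    × (∀ i → inS G T (f i) ≡ true)
    × (∀ v → inS G T v ≡ true → ∃ λ i → f i ≡ v)
    × (∀ i j → Radj G T (f i) (f j) ≡ starMatchAdj p q i j)

-- Let c be the centre of the star. Every vertex of R other than c has exactly one neighbour, so R has no
-- triangle and every 2-edge path of R has c as its middle vertex; hence μ(R) ≤ deg(c)². By the handshake
-- lemma 2e(R) ≥ deg(c) + (s − 1), since c contributes deg(c) and each of the other s − 1 vertices of S at least
-- one; also s − 1 ≥ deg(c), so e(R) ≥ deg(c). If t ≤ deg(c) then s + t − 1 ≤ s − 1 + deg(c) ≤ 2e(R), so T is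
-- dischargeable; otherwise t · e(R) ≥ deg(c)² ≥ μ(R), so T is foldable.
module Submission where

open import Defs
open import Data.Nat using (ℕ; _≤_)
open import Data.Fin.Subset using (Subset)
open import Data.Sum using (_⊎_)

open import Algebra.Bundles using (CommutativeMonoid)
open import Data.Bool using (Bool; true; false; _∧_; not)
import Data.Bool as Bool
open import Data.Bool.Properties using (∧-conicalˡ; ∧-conicalʳ; ∧-zeroʳ; T-≡; ∧-commutativeMonoid)
open import Data.Empty using (⊥)
open import Data.Fin as Fin using (Fin; zero; suc; toℕ; _≟_)
open import Data.Fin.Properties using (toℕ-injective; <⇒≢)
open import Data.Fin.Subset using (∣_∣)
import Data.List as List using (map; tabulate; allFin)
open import Data.List.Properties using (map-tabulate)
open import Data.Nat as ℕ using (zero; suc; _≥_; _+_; _*_; _∸_; _<_; _<ᵇ_; z≤n)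
import Data.Nat.ListAction as List
open import Data.Nat.Properties hiding (_≟_; <⇒≢)
open import Data.Product using (∃; _×_; _,_; proj₁; proj₂; uncurry)
open import Data.Sum using (inj₁; inj₂)
open import Data.Vec using (tabulate)
open import Function using (_∘_; id; Equivalence)
open import Relation.Nullary using (Dec; ¬_; yes; no; contradiction)
open import Relation.Nullary.Decidable using (⌊_⌋; ⌊⌋-map′)
import Relation.Binary.PropositionalEquality as ≡
open ≡ using (_≡_; _≢_; refl; trans; cong; cong₂; module ≡-Reasoning)

open import Algebra.Properties.CommutativeSemigroup (CommutativeMonoid.commutativeSemigroup ∧-commutativeMonoid)
  using (x∙yz≈y∙xz)
open import Algebra.Properties.Semiring.Sum +-*-semiring
  using (sum; sum-syntax; ∑-distrib-+; ∑-comm; *-distribˡ-sum; *-distribʳ-sum; sum-cong-≗; sum-replicate-zero)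

⌊⌋-yes : ∀ {A : Set} (a? : Dec A) → A → ⌊ a? ⌋ ≡ true
⌊⌋-yes (yes _) _ = refl
⌊⌋-yes (no ¬a) a = contradiction a ¬a

⌊⌋-no : ∀ {A : Set} (a? : Dec A) → ¬ A → ⌊ a? ⌋ ≡ false
⌊⌋-no (yes a) ¬a = contradiction a ¬a
⌊⌋-no (no _)  _  = refl

⌊⌋-witness : ∀ {A : Set} (a? : Dec A) → ⌊ a? ⌋ ≡ true → A
⌊⌋-witness (yes a) _ = a

⌊⌋-refute : ∀ {A : Set} (a? : Dec A) → ⌊ a? ⌋ ≡ false → ¬ A
⌊⌋-refute (no ¬a) _ = ¬a

⌊≟⌋-sym : ∀ {n} (u v : Fin n) → ⌊ u ≟ v ⌋ ≡ ⌊ v ≟ u ⌋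
⌊≟⌋-sym u v with u ≟ v
... | yes refl = ≡.sym (⌊⌋-yes (u ≟ u) refl)
... | no u≢v   = ≡.sym (⌊⌋-no (v ≟ u) (u≢v ∘ ≡.sym))

𝟙 : Bool → ℕ
𝟙 true  = 1
𝟙 false = 0

𝟙-∧ : ∀ a b → 𝟙 (a ∧ b) ≡ 𝟙 a * 𝟙 b
𝟙-∧ true  true  = refl
𝟙-∧ true  false = refl
𝟙-∧ false _     = refl

𝟙≤ : ∀ {k} b → (b ≡ true → 1 ≤ k) → 𝟙 b ≤ k
𝟙≤ true  1≤k = 1≤k refl
𝟙≤ false _   = z≤n

𝟙≡0 : ∀ b → ¬ (b ≡ true) → 𝟙 b ≡ 0
𝟙≡0 true  b≢true = contradiction refl b≢true
𝟙≡0 false _      = refl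

𝟙≤𝟙+𝟙∧not : ∀ a b → 𝟙 a ≤ 𝟙 b + 𝟙 (a ∧ not b)
𝟙≤𝟙+𝟙∧not true  true  = ≤-refl
𝟙≤𝟙+𝟙∧not true  false = ≤-refl
𝟙≤𝟙+𝟙∧not false _     = z≤n

𝟙-∧-not : ∀ {a b} → a ≡ true → b ≡ false → 𝟙 (a ∧ not b) ≡ 1
𝟙-∧-not refl refl = refl

𝟙*+𝟙∧not≤ : ∀ {d k} b s → (b ≡ true → d ≤ k) → (s ≡ true → b ≡ false → 1 ≤ k) → 𝟙 b * d + 𝟙 (s ∧ not b) ≤ k
𝟙*+𝟙∧not≤ {d} true s d≤k _ =
  ≤-trans (≤-reflexive (trans (cong (λ b → 1 * d + 𝟙 b) (∧-zeroʳ s)) (trans (+-identityʳ _) (*-identityˡ d)))) (d≤k refl)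
𝟙*+𝟙∧not≤ false true  _ 1≤k = 1≤k refl refl
𝟙*+𝟙∧not≤ false false _ _   = z≤n

𝟙-sum≡3 : ∀ a b c → 𝟙 a + 𝟙 b + 𝟙 c ≡ 3 → a ≡ true × b ≡ true × c ≡ true
𝟙-sum≡3 true  true  true  _  = refl , refl , refl
𝟙-sum≡3 true  true  false ()
𝟙-sum≡3 true  false true  ()
𝟙-sum≡3 true  false false ()
𝟙-sum≡3 false true  true  ()
𝟙-sum≡3 false true  false ()
𝟙-sum≡3 false false true  ()
𝟙-sum≡3 false false false ()

𝟙-sum≡2 : ∀ a b c → 𝟙 a + 𝟙 b + 𝟙 c ≡ 2 →
          (a ≡ true × b ≡ true) ⊎ (a ≡ true × c ≡ true) ⊎ (b ≡ true × c ≡ true)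
𝟙-sum≡2 true  true  true  ()
𝟙-sum≡2 true  true  false _  = inj₁ (refl , refl)
𝟙-sum≡2 true  false true  _  = inj₂ (inj₁ (refl , refl))
𝟙-sum≡2 true  false false ()
𝟙-sum≡2 false true  true  _  = inj₂ (inj₂ (refl , refl))
𝟙-sum≡2 false true  false ()
𝟙-sum≡2 false false true  ()
𝟙-sum≡2 false false false ()

𝟙-sum≤1 : ∀ a b c → (a ≡ true → b ≡ true → ⊥) → (a ≡ true → c ≡ true → ⊥) → (b ≡ true → c ≡ true → ⊥) →
          𝟙 a + 𝟙 b + 𝟙 c ≤ 1
𝟙-sum≤1 true  true  _     a∥b _   _   = contradiction refl (a∥b refl)
𝟙-sum≤1 true  false true  _   a∥c _   = contradiction refl (a∥c refl)
𝟙-sum≤1 false true  true  _   _   b∥c = contradiction refl (b∥c refl)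
𝟙-sum≤1 true  false false _   _   _   = ≤-refl
𝟙-sum≤1 false true  false _   _   _   = ≤-refl
𝟙-sum≤1 false false true  _   _   _   = ≤-refl
𝟙-sum≤1 false false false _   _   _   = z≤n

≤+₁ : ∀ {m} a b c → m ≤ a → m ≤ a + b + c
≤+₁ a b c m≤a = ≤-trans m≤a (≤-trans (m≤m+n a b) (m≤m+n (a + b) c))

≤+₂ : ∀ {m} a b c → m ≤ b → m ≤ a + b + c
≤+₂ a b c m≤b = ≤-trans m≤b (≤-trans (m≤n+m b a) (m≤m+n (a + b) c))

≤+₃ : ∀ {m} a b c → m ≤ c → m ≤ a + b + c
≤+₃ a b c m≤c = ≤-trans m≤c (m≤n+m c (a + b))

<ᵇ⇒<′ : ∀ {m n} → (m <ᵇ n) ≡ true → m < n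
<ᵇ⇒<′ {m} {n} m<ᵇn = <ᵇ⇒< m n (Equivalence.from T-≡ m<ᵇn)

<⇒<ᵇ′ : ∀ {m n} → m < n → (m <ᵇ n) ≡ true
<⇒<ᵇ′ m<n = Equivalence.to T-≡ (<⇒<ᵇ m<n)

𝟙-<ᵇ-connex : ∀ {m n} → m ≢ n → 𝟙 (m <ᵇ n) + 𝟙 (n <ᵇ m) ≡ 1
𝟙-<ᵇ-connex {zero}  {zero}  m≢n = contradiction refl m≢n
𝟙-<ᵇ-connex {zero}  {suc n} _   = refl
𝟙-<ᵇ-connex {suc m} {zero}  _   = refl
𝟙-<ᵇ-connex {suc m} {suc n} m≢n = 𝟙-<ᵇ-connex (m≢n ∘ cong suc)

-- Finite sums over Fin n

sum-mono-≤ : ∀ {n} {f g : Fin n → ℕ} → (∀ i → f i ≤ g i) → sum f ≤ sum g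
sum-mono-≤ {zero}  _   = z≤n
sum-mono-≤ {suc n} f≤g = +-mono-≤ (f≤g zero) (sum-mono-≤ (f≤g ∘ suc))

sum-zero : ∀ {n} {f : Fin n → ℕ} → (∀ i → f i ≡ 0) → sum f ≡ 0
sum-zero {n} f≡0 = trans (sum-cong-≗ f≡0) (sum-replicate-zero n)

term≤sum : ∀ {n} (f : Fin n → ℕ) i → f i ≤ sum f
term≤sum f zero    = m≤m+n _ _
term≤sum f (suc i) = ≤-trans (term≤sum (f ∘ suc) i) (m≤n+m _ _)

δ : ∀ {n} → Fin n → Fin n → ℕ
δ c u = 𝟙 ⌊ u ≟ c ⌋

δ-suc : ∀ {n} (c u : Fin n) → δ (suc c) (suc u) ≡ δ c u
δ-suc c u = cong 𝟙 (⌊⌋-map′ _ _ (u ≟ c))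

δ-self : ∀ {n} (c : Fin n) → δ c c ≡ 1
δ-self c = cong 𝟙 (⌊⌋-yes (c ≟ c) refl)

sum-δ* : ∀ {n} (c : Fin n) (h : Fin n → ℕ) → ∑[ u < n ] (δ c u * h u) ≡ h c
sum-δ* {suc n} zero    h = trans (cong (1 * h zero +_) (sum-replicate-zero n))
                                 (trans (+-identityʳ _) (*-identityˡ _))
sum-δ* {suc n} (suc c) h =
  trans (sum-cong-≗ (λ u → cong (_* h (suc u)) (δ-suc c u))) (sum-δ* c (h ∘ suc))

sum-δ : ∀ {n} (c : Fin n) → ∑[ u < n ] δ c u ≡ 1
sum-δ c = trans (sum-cong-≗ (λ u → ≡.sym (*-identityʳ (δ c u)))) (sum-δ* c (λ _ → 1))

sum-*-sum : ∀ {n} (f g : Fin n → ℕ) → ∑[ a < n ] ∑[ b < n ] (f a * g b) ≡ sum f * sum g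
sum-*-sum f g = begin
  ∑[ a < _ ] ∑[ b < _ ] (f a * g b) ≡⟨ sum-cong-≗ (λ a → ≡.sym (*-distribˡ-sum (f a) g)) ⟩
  ∑[ a < _ ] (f a * sum g)        ≡⟨ ≡.sym (*-distribʳ-sum (sum g) f) ⟩
  sum f * sum g                   ∎
  where open ≡-Reasoning

module _ {n : ℕ} where

  sum²-distrib-+ : (F G : Fin n → Fin n → ℕ) →
                   ∑[ a < n ] ∑[ b < n ] (F a b + G a b) ≡ ∑[ a < n ] ∑[ b < n ] F a b + ∑[ a < n ] ∑[ b < n ] G a b
  sum²-distrib-+ F G = trans (sum-cong-≗ (λ a → ∑-distrib-+ (F a) (G a)))
                             (∑-distrib-+ (λ a → sum (F a)) (λ a → sum (G a)))

  sum³-distrib-+ : (F G : Fin n → Fin n → Fin n → ℕ) →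
                   ∑[ u < n ] ∑[ v < n ] ∑[ x < n ] (F u v x + G u v x) ≡
                   ∑[ u < n ] ∑[ v < n ] ∑[ x < n ] F u v x + ∑[ u < n ] ∑[ v < n ] ∑[ x < n ] G u v x
  sum³-distrib-+ F G = trans (sum-cong-≗ (λ u → sum²-distrib-+ (F u) (G u)))
                             (∑-distrib-+ (λ u → ∑[ v < n ] sum (F u v)) (λ u → ∑[ v < n ] sum (G u v)))

  sum³-δ₁ : ∀ c (F : Fin n → Fin n → ℕ) →
            ∑[ u < n ] ∑[ v < n ] ∑[ x < n ] (δ c u * F v x) ≡ ∑[ v < n ] ∑[ x < n ] F v x
  sum³-δ₁ c F = trans (sum-cong-≗ λ u → trans (sum-cong-≗ λ v → ≡.sym (*-distribˡ-sum (δ c u) (F v)))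
                                              (≡.sym (*-distribˡ-sum (δ c u) (λ v → sum (F v)))))
                      (sum-δ* c (λ _ → ∑[ v < n ] sum (F v)))

  sum³-δ₂ : ∀ c (F : Fin n → Fin n → ℕ) →
            ∑[ u < n ] ∑[ v < n ] ∑[ x < n ] (δ c v * F u x) ≡ ∑[ u < n ] ∑[ x < n ] F u x
  sum³-δ₂ c F = sum-cong-≗ λ u → trans (sum-cong-≗ λ v → ≡.sym (*-distribˡ-sum (δ c v) (F u)))
                                       (sum-δ* c (λ _ → sum (F u)))

  sum³-δ₃ : ∀ c (F : Fin n → Fin n → ℕ) →
            ∑[ u < n ] ∑[ v < n ] ∑[ x < n ] (δ c x * F u v) ≡ ∑[ u < n ] ∑[ v < n ] F u v
  sum³-δ₃ c F = sum-cong-≗ λ u → sum-cong-≗ λ v → sum-δ* c (λ _ → F u v)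

  sum³-δ : ∀ c (F G H : Fin n → Fin n → ℕ) →
           ∑[ u < n ] ∑[ v < n ] ∑[ x < n ] (δ c u * F v x + δ c v * G u x + δ c x * H u v) ≡
           ∑[ a < n ] ∑[ b < n ] (F a b + G a b + H a b)
  sum³-δ c F G H = begin
    ∑[ u < n ] ∑[ v < n ] ∑[ x < n ] (δ c u * F v x + δ c v * G u x + δ c x * H u v)
      ≡⟨ sum³-distrib-+ (λ u v x → δ c u * F v x + δ c v * G u x) (λ u v x → δ c x * H u v) ⟩
    ∑[ u < n ] ∑[ v < n ] ∑[ x < n ] (δ c u * F v x + δ c v * G u x) + ∑³ (λ u v x → δ c x * H u v)
      ≡⟨ cong (_+ ∑³ (λ u v x → δ c x * H u v)) (sum³-distrib-+ (λ u v x → δ c u * F v x) (λ u v x → δ c v * G u x)) ⟩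
    ∑³ (λ u v x → δ c u * F v x) + ∑³ (λ u v x → δ c v * G u x) + ∑³ (λ u v x → δ c x * H u v)
      ≡⟨ cong₂ _+_ (cong₂ _+_ (sum³-δ₁ c F) (sum³-δ₂ c G)) (sum³-δ₃ c H) ⟩
    ∑² F + ∑² G + ∑² H
      ≡⟨ cong (_+ ∑² H) (sum²-distrib-+ F G) ⟨
    ∑² (λ a b → F a b + G a b) + ∑² H
      ≡⟨ sum²-distrib-+ (λ a b → F a b + G a b) H ⟨
    ∑[ a < n ] ∑[ b < n ] (F a b + G a b + H a b) ∎
    where
    open ≡-Reasoning
    ∑² : (Fin n → Fin n → ℕ) → ℕ
    ∑² F = ∑[ a < n ] ∑[ b < n ] F a b
    ∑³ : (Fin n → Fin n → Fin n → ℕ) → ℕ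
    ∑³ F = ∑[ u < n ] ∑[ v < n ] ∑[ x < n ] F u v x

count≡sum𝟙 : ∀ {n} (f : Fin n → Bool) → ∣ tabulate f ∣ ≡ ∑[ i < n ] 𝟙 (f i)
count≡sum𝟙 {zero}  f = refl
count≡sum𝟙 {suc n} f with f zero
... | true  = cong suc (count≡sum𝟙 (f ∘ suc))
... | false = count≡sum𝟙 (f ∘ suc)

listSum-tabulate : ∀ {n} (f : Fin n → ℕ) → List.sum (List.tabulate f) ≡ sum f
listSum-tabulate {zero}  f = refl
listSum-tabulate {suc n} f = cong (f zero +_) (listSum-tabulate (f ∘ suc))

listSum-allFin : ∀ {n} (f : Fin n → ℕ) → List.sum (List.map f (List.allFin n)) ≡ sum f
listSum-allFin f = trans (cong List.sum (map-tabulate id f)) (listSum-tabulate f)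

listSum²-count≡sum³ : ∀ {n} (φ : Fin n → Fin n → Fin n → Bool) →
  List.sum (List.map (λ u → List.sum (List.map (λ v → ∣ tabulate (φ u v) ∣) (List.allFin n))) (List.allFin n))
  ≡ ∑[ u < n ] ∑[ v < n ] ∑[ x < n ] 𝟙 (φ u v x)
listSum²-count≡sum³ {n} φ =
  trans (listSum-allFin (λ u → List.sum (List.map (λ v → ∣ tabulate (φ u v) ∣) (List.allFin n))))
        (sum-cong-≗ λ u → trans (listSum-allFin (λ v → ∣ tabulate (φ u v) ∣)) (sum-cong-≗ λ v → count≡sum𝟙 (φ u v)))

-- Graphs given by a symmetric Boolean adjacency relation on Fin n

module _ {n : ℕ} where

  degree : (Fin n → Fin n → Bool) → Fin n → ℕ
  degree R u = ∑[ v < n ] 𝟙 (R u v)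

  edgeCount : (Fin n → Fin n → Bool) → ℕ
  edgeCount R = ∑[ u < n ] ∑[ v < n ] 𝟙 ((toℕ u <ᵇ toℕ v) ∧ R u v)

  increasing : Fin n → Fin n → Fin n → Bool
  increasing u v x = (toℕ u <ᵇ toℕ v) ∧ (toℕ v <ᵇ toℕ x)

  edgesAmong : (Fin n → Fin n → Bool) → Fin n → Fin n → Fin n → ℕ
  edgesAmong R u v x = 𝟙 (R u v) + 𝟙 (R u x) + 𝟙 (R v x)

  isInducedTriple : (Fin n → Bool) → (Fin n → Fin n → Bool) → ℕ → Fin n → Fin n → Fin n → Bool
  isInducedTriple S R k u v x = increasing u v x ∧ S u ∧ S v ∧ S x ∧ ⌊ edgesAmong R u v x ℕ.≟ k ⌋

  inducedTriples : (Fin n → Bool) → (Fin n → Fin n → Bool) → ℕ → ℕ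
  inducedTriples S R k = ∑[ u < n ] ∑[ v < n ] ∑[ x < n ] 𝟙 (isInducedTriple S R k u v x)

  _∖_ : (Fin n → Bool) → Fin n → Fin n → Bool
  (S ∖ c) u = S u ∧ not ⌊ u ≟ c ⌋

  increasing⇒< : ∀ u v x → increasing u v x ≡ true → u Fin.< v × v Fin.< x
  increasing⇒< _ _ _ h = <ᵇ⇒<′ (∧-conicalˡ _ _ h) , <ᵇ⇒<′ (∧-conicalʳ _ _ h)

  <⇒increasing : ∀ {u v x} → u Fin.< v → v Fin.< x → increasing u v x ≡ true
  <⇒increasing u<v v<x rewrite <⇒<ᵇ′ u<v | <⇒<ᵇ′ v<x = refl

  unique-position : ∀ a b z → 𝟙 (increasing z a b) + 𝟙 (increasing a z b) + 𝟙 (increasing a b z) ≤ 1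
  unique-position a b z = 𝟙-sum≤1 _ _ _
    (λ zab azb → <-asym (proj₁ (increasing⇒< z a b zab)) (proj₁ (increasing⇒< a z b azb)))
    (λ zab abz → <-asym (uncurry <-trans (increasing⇒< z a b zab)) (proj₂ (increasing⇒< a b z abz)))
    (λ azb abz → <-asym (proj₂ (increasing⇒< a z b azb)) (proj₂ (increasing⇒< a b z abz)))

  isInducedTriple⇒ : ∀ {S R k} u v x → isInducedTriple S R k u v x ≡ true →
                     u Fin.< v × v Fin.< x × edgesAmong R u v x ≡ k
  isInducedTriple⇒ {S} {R} {k} u v x h =
    let u<v , v<x = increasing⇒< u v x (∧-conicalˡ _ _ h)
        e≟k       = ∧-conicalʳ (S x) _ (∧-conicalʳ (S v) _ (∧-conicalʳ (S u) _ (∧-conicalʳ (increasing u v x) _ h)))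
    in  u<v , v<x , ⌊⌋-witness (edgesAmong R u v x ℕ.≟ k) e≟k

  adjacent⇒≢ : {R : Fin n → Fin n → Bool} → (∀ u → R u u ≡ false) → ∀ {u v} → R u v ≡ true → u ≢ v
  adjacent⇒≢ R-irrefl {u} Ruv refl = contradiction (trans (≡.sym Ruv) (R-irrefl u)) λ ()

  handshake : (R : Fin n → Fin n → Bool) → (∀ u v → R u v ≡ R v u) → (∀ u → R u u ≡ false) →
              ∑[ u < n ] degree R u ≡ 2 * edgeCount R
  handshake R R-sym R-irrefl = begin
    ∑[ u < n ] ∑[ v < n ] 𝟙 (R u v)
      ≡⟨ sum-cong-≗ (λ u → sum-cong-≗ (λ v → split u v)) ⟩
    ∑[ u < n ] ∑[ v < n ] (forward u v + forward v u)
      ≡⟨ sum-cong-≗ (λ u → ∑-distrib-+ (forward u) (λ v → forward v u)) ⟩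
    ∑[ u < n ] (∑[ v < n ] forward u v + ∑[ v < n ] forward v u)
      ≡⟨ ∑-distrib-+ (λ u → ∑[ v < n ] forward u v) (λ u → ∑[ v < n ] forward v u) ⟩
    edgeCount R + ∑[ u < n ] ∑[ v < n ] forward v u
      ≡⟨ cong (edgeCount R +_) (∑-comm (λ u v → forward v u)) ⟩
    edgeCount R + edgeCount R
      ≡⟨ cong (edgeCount R +_) (≡.sym (+-identityʳ _)) ⟩
    2 * edgeCount R ∎
    where
    open ≡-Reasoning
    forward : Fin n → Fin n → ℕ
    forward u v = 𝟙 ((toℕ u <ᵇ toℕ v) ∧ R u v)

    orientations : ∀ u v → (𝟙 (toℕ u <ᵇ toℕ v) + 𝟙 (toℕ v <ᵇ toℕ u)) * 𝟙 (R u v) ≡ 𝟙 (R u v)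
    orientations u v with R u v in Ruv
    ... | false = *-zeroʳ (𝟙 (toℕ u <ᵇ toℕ v) + 𝟙 (toℕ v <ᵇ toℕ u))
    ... | true  = cong (_* 1) (𝟙-<ᵇ-connex (adjacent⇒≢ {R = R} R-irrefl Ruv ∘ toℕ-injective))

    split : ∀ u v → 𝟙 (R u v) ≡ forward u v + forward v u
    split u v = ≡.sym (begin
      forward u v + forward v u
        ≡⟨ cong₂ _+_ (𝟙-∧ (toℕ u <ᵇ toℕ v) (R u v))
                     (trans (cong (λ b → 𝟙 ((toℕ v <ᵇ toℕ u) ∧ b)) (R-sym v u)) (𝟙-∧ (toℕ v <ᵇ toℕ u) (R u v))) ⟩
      𝟙 (toℕ u <ᵇ toℕ v) * 𝟙 (R u v) + 𝟙 (toℕ v <ᵇ toℕ u) * 𝟙 (R u v)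
        ≡⟨ ≡.sym (*-distribʳ-+ (𝟙 (R u v)) (𝟙 (toℕ u <ᵇ toℕ v)) (𝟙 (toℕ v <ᵇ toℕ u))) ⟩
      (𝟙 (toℕ u <ᵇ toℕ v) + 𝟙 (toℕ v <ᵇ toℕ u)) * 𝟙 (R u v)
        ≡⟨ orientations u v ⟩
      𝟙 (R u v) ∎)

  adjacent⇒1≤degree : ∀ {R : Fin n → Fin n → Bool} {u v} → R u v ≡ true → 1 ≤ degree R u
  adjacent⇒1≤degree {R} {u} {v} Ruv = ≤-trans (≤-reflexive (cong 𝟙 (≡.sym Ruv))) (term≤sum (λ v → 𝟙 (R u v)) v)

module BranchingOnlyAt {n : ℕ} (R : Fin n → Fin n → Bool) (R-sym : ∀ u v → R u v ≡ R v u) (c : Fin n)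
  (branching⇒centre : ∀ {w a b} → R w a ≡ true → R w b ≡ true → a ≢ b → w ≡ c) where

  private
    R-flip : ∀ {u v} → R u v ≡ true → R v u ≡ true
    R-flip {u} {v} Ruv = trans (R-sym v u) Ruv

  triangle-free : ∀ S → inducedTriples S R 3 ≡ 0
  triangle-free S = sum-zero λ u → sum-zero λ v → sum-zero λ x → 𝟙≡0 _ (noTriangle u v x)
    where
    noTriangle : ∀ u v x → ¬ (isInducedTriple S R 3 u v x ≡ true)
    noTriangle u v x h with isInducedTriple⇒ {S = S} {R = R} u v x h
    ... | u<v , v<x , three with 𝟙-sum≡3 (R u v) (R u x) (R v x) three
    ... | Ruv , Rux , Rvx = <⇒≢ u<v (trans u≡c (≡.sym v≡c))
      where
      u≡c = branching⇒centre Ruv Rux (<⇒≢ v<x)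
      v≡c = branching⇒centre (R-flip Ruv) Rvx (<⇒≢ (<-trans u<v v<x))

  private
    L : Fin n → ℕ
    L a = 𝟙 (R c a)

    wedge : Fin n → Fin n → Fin n → Fin n → Fin n → ℕ
    wedge u v x a b = 𝟙 (increasing u v x) * (L a * L b)

    -- A 2-edge triple u < v < x is a path whose middle vertex is c; the three terms count it according to
    -- where c sits among u < v < x.
    wedges : Fin n → Fin n → Fin n → ℕ
    wedges u v x = δ c u * wedge c v x v x + δ c v * wedge u c x u x + δ c x * wedge u v c u v

    1≤wedge : ∀ u v x {a b} → increasing u v x ≡ true → R c a ≡ true → R c b ≡ true → 1 ≤ δ c c * wedge u v x a b
    1≤wedge _ _ _ inc Rca Rcb rewrite inc | Rca | Rcb = ≤-reflexive (≡.sym (trans (*-identityʳ (δ c c)) (δ-self c)))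

    first≤wedges : ∀ u v x → δ c u * wedge c v x v x ≤ wedges u v x
    first≤wedges u v x = ≤+₁ _ (δ c v * wedge u c x u x) (δ c x * wedge u v c u v) ≤-refl

    second≤wedges : ∀ u v x → δ c v * wedge u c x u x ≤ wedges u v x
    second≤wedges u v x = ≤+₂ (δ c u * wedge c v x v x) _ (δ c x * wedge u v c u v) ≤-refl

    third≤wedges : ∀ u v x → δ c x * wedge u v c u v ≤ wedges u v x
    third≤wedges u v x = ≤+₃ (δ c u * wedge c v x v x) (δ c v * wedge u c x u x) _ ≤-refl

    pathThroughCentre : ∀ u v x → u Fin.< v → v Fin.< x → edgesAmong R u v x ≡ 2 → 1 ≤ wedges u v x
    pathThroughCentre u v x u<v v<x two with 𝟙-sum≡2 (R u v) (R u x) (R v x) two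
    ... | inj₁ (Ruv , Rux) with refl ← branching⇒centre Ruv Rux (<⇒≢ v<x) =
      ≤-trans (1≤wedge u v x (<⇒increasing u<v v<x) Ruv Rux) (first≤wedges u v x)
    ... | inj₂ (inj₁ (Ruv , Rvx)) with refl ← branching⇒centre (R-flip Ruv) Rvx (<⇒≢ (<-trans u<v v<x)) =
      ≤-trans (1≤wedge u v x (<⇒increasing u<v v<x) (R-flip Ruv) Rvx) (second≤wedges u v x)
    ... | inj₂ (inj₂ (Rux , Rvx)) with refl ← branching⇒centre (R-flip Rux) (R-flip Rvx) (<⇒≢ u<v) =
      ≤-trans (1≤wedge u v x (<⇒increasing u<v v<x) (R-flip Rux) (R-flip Rvx)) (third≤wedges u v x)

    path≤wedges : ∀ S u v x → 𝟙 (isInducedTriple S R 2 u v x) ≤ wedges u v x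
    path≤wedges S u v x = 𝟙≤ _ λ h →
      let u<v , v<x , two = isInducedTriple⇒ {S = S} {R = R} u v x h in pathThroughCentre u v x u<v v<x two

    atMostOnePosition : ∀ a b → wedge c a b a b + wedge a c b a b + wedge a b c a b ≤ L a * L b
    atMostOnePosition a b = begin
      P₁ * Q + P₂ * Q + P₃ * Q ≡⟨ cong (_+ P₃ * Q) (*-distribʳ-+ Q P₁ P₂) ⟨
      (P₁ + P₂) * Q + P₃ * Q   ≡⟨ *-distribʳ-+ Q (P₁ + P₂) P₃ ⟨
      (P₁ + P₂ + P₃) * Q       ≤⟨ *-monoˡ-≤ Q (unique-position a b c) ⟩
      1 * Q                    ≡⟨ *-identityˡ Q ⟩
      Q                        ∎
      where
      open ≤-Reasoning
      Q = L a * L b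
      P₁ = 𝟙 (increasing c a b)
      P₂ = 𝟙 (increasing a c b)
      P₃ = 𝟙 (increasing a b c)

  paths≤degree² : ∀ S → inducedTriples S R 2 ≤ degree R c * degree R c
  paths≤degree² S = begin
    inducedTriples S R 2
      ≤⟨ sum-mono-≤ (λ u → sum-mono-≤ (λ v → sum-mono-≤ (λ x → path≤wedges S u v x))) ⟩
    ∑[ u < n ] ∑[ v < n ] ∑[ x < n ] wedges u v x
      ≡⟨ sum³-δ c (λ a b → wedge c a b a b) (λ a b → wedge a c b a b) (λ a b → wedge a b c a b) ⟩
    ∑[ a < n ] ∑[ b < n ] (wedge c a b a b + wedge a c b a b + wedge a b c a b)
      ≤⟨ sum-mono-≤ (λ a → sum-mono-≤ (λ b → atMostOnePosition a b)) ⟩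
    ∑[ a < n ] ∑[ b < n ] (L a * L b)
      ≡⟨ sum-*-sum L L ⟩
    degree R c * degree R c ∎
    where open ≤-Reasoning

module _ {n : ℕ} (S : Fin n → Bool) (c : Fin n) where

  size≤1+size∖ : ∑[ u < n ] 𝟙 (S u) ≤ 1 + ∑[ u < n ] 𝟙 ((S ∖ c) u)
  size≤1+size∖ = begin
    ∑[ u < n ] 𝟙 (S u)                              ≤⟨ sum-mono-≤ (λ u → 𝟙≤𝟙+𝟙∧not (S u) ⌊ u ≟ c ⌋) ⟩
    ∑[ u < n ] (δ c u + 𝟙 ((S ∖ c) u))              ≡⟨ ∑-distrib-+ (δ c) (λ u → 𝟙 ((S ∖ c) u)) ⟩
    ∑[ u < n ] δ c u + ∑[ u < n ] 𝟙 ((S ∖ c) u)     ≡⟨ cong (_+ ∑[ u < n ] 𝟙 ((S ∖ c) u)) (sum-δ c) ⟩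
    1 + ∑[ u < n ] 𝟙 ((S ∖ c) u)                    ∎
    where open ≤-Reasoning

  degree≤size∖ : ∀ {R} → (∀ u → R u u ≡ false) → (∀ {u v} → R u v ≡ true → S v ≡ true) →
                 degree R c ≤ ∑[ u < n ] 𝟙 ((S ∖ c) u)
  degree≤size∖ {R} R-irrefl R⇒S = sum-mono-≤ λ u → 𝟙≤ (R c u) λ Rcu →
    ≤-reflexive (≡.sym (𝟙-∧-not (R⇒S Rcu) (⌊⌋-no (u ≟ c) (adjacent⇒≢ {R = R} R-irrefl Rcu ∘ ≡.sym))))

  degree+size∖≤degreeSum : ∀ {R} → (∀ {u} → S u ≡ true → u ≢ c → ∃ λ v → R u v ≡ true) →
                           degree R c + ∑[ u < n ] 𝟙 ((S ∖ c) u) ≤ ∑[ u < n ] degree R u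
  degree+size∖≤degreeSum {R} S⇒adjacent = begin
    degree R c + ∑[ u < n ] 𝟙 ((S ∖ c) u)
      ≡⟨ cong (_+ ∑[ u < n ] 𝟙 ((S ∖ c) u)) (sum-δ* c (λ _ → degree R c)) ⟨
    ∑[ u < n ] (δ c u * degree R c) + ∑[ u < n ] 𝟙 ((S ∖ c) u)
      ≡⟨ ∑-distrib-+ (λ u → δ c u * degree R c) (λ u → 𝟙 ((S ∖ c) u)) ⟨
    ∑[ u < n ] (δ c u * degree R c + 𝟙 ((S ∖ c) u))
      ≤⟨ sum-mono-≤ (λ u → 𝟙*+𝟙∧not≤ ⌊ u ≟ c ⌋ (S u)
                              (λ u≟c → ≤-reflexive (cong (degree R) (≡.sym (⌊⌋-witness (u ≟ c) u≟c))))
                              (λ Su u≟c → adjacent⇒1≤degree {R = R} (proj₂ (S⇒adjacent Su (⌊⌋-refute (u ≟ c) u≟c))))) ⟩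
    ∑[ u < n ] degree R u ∎
    where open ≤-Reasoning

-- The associated graph R of a cluster

module _ {n : ℕ} (G : Graph n) (T : Subset n) where

  Radj-sym : ∀ u v → Radj G T u v ≡ Radj G T v u
  Radj-sym u v rewrite ⌊≟⌋-sym u v | Graph.sym G u v = x∙yz≈y∙xz (inS G T u) (inS G T v) _

  Radj-irrefl : ∀ u → Radj G T u u ≡ false
  Radj-irrefl u rewrite ⌊⌋-yes (u ≟ u) refl = trans (cong (inS G T u ∧_) (∧-zeroʳ (inS G T u))) (∧-zeroʳ (inS G T u))

  Radj⇒inSˡ : ∀ {u v} → Radj G T u v ≡ true → inS G T u ≡ true
  Radj⇒inSˡ h = ∧-conicalˡ _ _ h

  Radj⇒inSʳ : ∀ {u v} → Radj G T u v ≡ true → inS G T v ≡ true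
  Radj⇒inSʳ {u} h = ∧-conicalˡ _ _ (∧-conicalʳ (inS G T u) _ h)

  -- edges3 counts with a Bool → ℕ conversion local to Defs, which computes only on literals.
  edges3≡edgesAmong : ∀ u v x → edges3 G T u v x ≡ edgesAmong (Radj G T) u v x
  edges3≡edgesAmong u v x with Radj G T u v | Radj G T u x | Radj G T v x
  ... | true  | true  | true  = refl
  ... | true  | true  | false = refl
  ... | true  | false | true  = refl
  ... | true  | false | false = refl
  ... | false | true  | true  = refl
  ... | false | true  | false = refl
  ... | false | false | true  = refl
  ... | false | false | false = refl

  private
    tripleCondition : ℕ → Fin n → Fin n → Fin n → Bool
    tripleCondition k u v x = increasing u v x ∧ inS G T u ∧ inS G T v ∧ inS G T x ∧ ⌊ edges3 G T u v x ℕ.≟ k ⌋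

    isInducedTriple≡ : ∀ k u v x → 𝟙 (tripleCondition k u v x) ≡ 𝟙 (isInducedTriple (inS G T) (Radj G T) k u v x)
    isInducedTriple≡ k u v x =
      cong (λ e → 𝟙 (increasing u v x ∧ inS G T u ∧ inS G T v ∧ inS G T x ∧ ⌊ e ℕ.≟ k ⌋)) (edges3≡edgesAmong u v x)

  triR≡inducedTriples : triR G T ≡ inducedTriples (inS G T) (Radj G T) 3
  triR≡inducedTriples = trans (listSum²-count≡sum³ (tripleCondition 3))
    (sum-cong-≗ λ u → sum-cong-≗ λ v → sum-cong-≗ λ x → isInducedTriple≡ 3 u v x)

  p3R≡inducedTriples : p3R G T ≡ inducedTriples (inS G T) (Radj G T) 2
  p3R≡inducedTriples = trans (listSum²-count≡sum³ (tripleCondition 2))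
    (sum-cong-≗ λ u → sum-cong-≗ λ v → sum-cong-≗ λ x → isInducedTriple≡ 2 u v x)

  eR≡edgeCount : eR G T ≡ edgeCount (Radj G T)
  eR≡edgeCount = trans (listSum-allFin (λ u → count G (forward u))) (sum-cong-≗ λ u → count≡sum𝟙 (forward u))
    where
    forward : Fin n → Fin n → Bool
    forward u v = (toℕ u <ᵇ toℕ v) ∧ Radj G T u v

  sSize≡size : sSize G T ≡ ∑[ u < n ] 𝟙 (inS G T u)
  sSize≡size = count≡sum𝟙 (inS G T)

-- The model graph K_{1,p} ∪ qK_2 and its transport to R

module _ {p q : ℕ} where

  centre : StarMatchV p q
  centre = inj₁ zero

  starMatch-partner : ∀ {k b} j → starMatchAdj p q (inj₂ (k , b)) j ≡ true → j ≡ inj₂ (k , not b)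
  starMatch-partner {k} {b} (inj₂ (k′ , b′)) h =
    cong₂ (λ k b → inj₂ (k , b)) (≡.sym (⌊⌋-witness (k ≟ k′) (∧-conicalˡ _ _ h))) (other b b′ (∧-conicalʳ _ _ h))
    where
    other : ∀ b b′ → not ⌊ b Bool.≟ b′ ⌋ ≡ true → b′ ≡ not b
    other true  false _ = refl
    other false true  _ = refl

  starMatch-adjacent-partner : ∀ k b → starMatchAdj p q (inj₂ (k , b)) (inj₂ (k , not b)) ≡ true
  starMatch-adjacent-partner k b rewrite ⌊⌋-yes (k ≟ k) refl with b
  ... | true  = refl
  ... | false = refl

  starMatch-branching⇒centre : ∀ {i j k} → starMatchAdj p q i j ≡ true → starMatchAdj p q i k ≡ true → j ≢ k →
                               i ≡ centre
  starMatch-branching⇒centre {inj₁ zero}    _  _  _   = refl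
  starMatch-branching⇒centre {inj₁ (suc _)} {inj₁ zero} {inj₁ zero} _ _ j≢k = contradiction refl j≢k
  starMatch-branching⇒centre {inj₂ _} {j} {k} ij ik j≢k =
    contradiction (trans (starMatch-partner j ij) (≡.sym (starMatch-partner k ik))) j≢k

  starMatch-adjacent : ∀ i → i ≢ centre → ∃ λ j → starMatchAdj p q i j ≡ true
  starMatch-adjacent (inj₁ zero)    i≢centre = contradiction refl i≢centre
  starMatch-adjacent (inj₁ (suc _)) _        = centre , refl
  starMatch-adjacent (inj₂ (k , b)) _        = inj₂ (k , not b) , starMatch-adjacent-partner k b

module StarMatchingIso {n : ℕ} (G : Graph n) (T : Subset n) (p q : ℕ) (iso : RIsoStarMatching G T p q) where

  private
    f : StarMatchV p q → Fin n
    f = proj₁ iso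

    onto : ∀ v → inS G T v ≡ true → ∃ λ i → f i ≡ v
    onto = proj₁ (proj₂ (proj₂ (proj₂ iso)))

    f-adjacency : ∀ i j → Radj G T (f i) (f j) ≡ starMatchAdj p q i j
    f-adjacency = proj₂ (proj₂ (proj₂ (proj₂ iso)))

  isoCentre : Fin n
  isoCentre = f centre

  Radj-branching⇒isoCentre : ∀ {w a b} → Radj G T w a ≡ true → Radj G T w b ≡ true → a ≢ b → w ≡ isoCentre
  Radj-branching⇒isoCentre wa wb a≢b
    with onto _ (Radj⇒inSˡ G T wa) | onto _ (Radj⇒inSʳ G T wa) | onto _ (Radj⇒inSʳ G T wb)
  ... | i , refl | j , refl | k , refl =
    cong f (starMatch-branching⇒centre (trans (≡.sym (f-adjacency i j)) wa) (trans (≡.sym (f-adjacency i k)) wb)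
                                       (a≢b ∘ cong f))

  inS⇒Radj-adjacent : ∀ {u} → inS G T u ≡ true → u ≢ isoCentre → ∃ λ v → Radj G T u v ≡ true
  inS⇒Radj-adjacent Su u≢centre with onto _ Su
  ... | i , refl with starMatch-adjacent i (u≢centre ∘ cong f)
  ... | j , ij = f j , trans (f-adjacency i j) ij

dischargeable-or-foldable : ∀ {s t e k d tri p3} → s ≤ 1 + k → d ≤ k → d + k ≤ 2 * e → tri ≡ 0 → p3 ≤ d * d →
                            2 * e ≥ s + t ∸ 1 ⊎ t * e ≥ 2 * tri + p3
dischargeable-or-foldable {s} {t} {e} {k} {d} {p3 = p3} s≤1+k d≤k d+k≤2e refl p3≤d² with t ℕ.≤? d
... | yes t≤d = inj₁ (begin
  s + t ∸ 1     ≤⟨ ∸-monoˡ-≤ 1 (+-mono-≤ s≤1+k t≤d) ⟩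
  k + d         ≡⟨ +-comm k d ⟩
  d + k         ≤⟨ d+k≤2e ⟩
  2 * e         ∎)
  where open ≤-Reasoning
... | no t≰d = inj₂ (begin
  p3            ≤⟨ p3≤d² ⟩
  d * d         ≤⟨ *-mono-≤ (<⇒≤ (≰⇒> t≰d)) d≤e ⟩
  t * e         ∎)
  where
  open ≤-Reasoning
  d≤e : d ≤ e
  d≤e = *-cancelˡ-≤ 2 (begin
    2 * d ≡⟨ cong (d +_) (+-identityʳ d) ⟩
    d + d ≤⟨ +-monoʳ-≤ d d≤k ⟩
    d + k ≤⟨ d+k≤2e ⟩
    2 * e ∎)

mainTheorem9 : (r : ℕ) → 1 ≤ r → {n : ℕ} → (G : Graph n) → MaxDegree≤ G r
    → (T : Subset n) → Cluster G r T
    → (p q : ℕ) → RIsoStarMatching G T p q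
    → Dischargeable G T ⊎ Foldable G T
mainTheorem9 _ _ {n} G _ T _ p q iso =
  dischargeable-or-foldable
    (≤-trans (≤-reflexive (sSize≡size G T)) (size≤1+size∖ S c))
    (degree≤size∖ S c (Radj-irrefl G T) (Radj⇒inSʳ G T))
    (≤-trans (degree+size∖≤degreeSum S c inS⇒Radj-adjacent) (≤-reflexive degreeSum≡2eR))
    (trans (triR≡inducedTriples G T) (triangle-free S))
    (≤-trans (≤-reflexive (p3R≡inducedTriples G T)) (paths≤degree² S))
  where
  S = inS G T
  R = Radj G T
  open StarMatchingIso G T p q iso
  c = isoCentre
  open BranchingOnlyAt R (Radj-sym G T) c Radj-branching⇒isoCentre

  degreeSum≡2eR : ∑[ u < n ] degree R u ≡ 2 * eR G T
  degreeSum≡2eR = trans (handshake R (Radj-sym G T) (Radj-irrefl G T)) (cong (2 *_) (≡.sym (eR≡edgeCount G T)))
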